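{- Let $\Pi$ be a ground program with atom set $\mathcal{A}$, $A\subseteq\mathcal{A}$, and $\hat I\in AS(\mathit{omit}(\Pi,A))$. If $\hat I$ is spurious, then $\hat I$ is a u-core of $\Pi$ (as an assignment over $\mathcal{A}\setminus A$). Furthermore, if $A$ is maximal in the sense that there is no $A'\supset A$ such that $\mathit{omit}(\Pi,A')$ has a spurious answer set $\hat I'$ with $\hat I\cap(\mathcal{A}\setminus A')=\hat I'$, then $\hat I$ is a minimal u-core.
   Context: Ground programs consist of rules $\alpha_0 \leftarrow \alpha_1,\dots,\alpha_m,\mathit{not}\ \alpha_{m+1},\dots,\mathit{not}\ \alpha_n$ with $\alpha_0$ an atom or $\bot$ (constraint), possibly with choice rules $\{\alpha\}\leftarrow B$ (abbreviating $\alpha\leftarrow B,\mathit{not}\ \bar\alpha$ and $\bar\alpha\leftarrow B,\mathit{not}\ \alpha$ with fresh $\bar\alpha$, projected away from answer sets). $H(r)$, $B^+(r)$, $B^-(r)$, $B^\pm(r)=B^+(r)\cup B^-(r)$, $B(r)$ denote head, positive body, negative body, all body atoms, and body. $I$ is an answer set of $\Pi$ iff $I$ is a $\subseteq$-minimal model of $\{r\in\Pi\mid I\models B(r)\}$; $AS(\Pi)$ is the set of answer sets. For $A\subseteq\mathcal{A}$, $\mathit{omit}(r,A)$ is $r$ if $A\cap B^\pm(r)=\emptyset$ and $H(r)\notin A$; is $\{H(r)\}\leftarrow B^+(r)\setminus A,\mathit{not}\ (B^-(r)\setminus A)$ if $A\cap B^\pm(r)\neq\emptyset$ and $H(r)\notin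 A\cup\{\bot\}$; and is no rule otherwise (choice rules treated analogously). $\mathit{omit}(\Pi,A)=\bigcup_{r\in\Pi}\mathit{omit}(r,A)$. An answer set $\hat I$ of $\mathit{omit}(\Pi,A)$ is spurious if there is no $J\in AS(\Pi)$ with $J\cap(\mathcal{A}\setminus A)=\hat I$. A u-core of $\Pi$ is an assignment $I$ over a subset $C\subseteq\mathcal{A}$ (represented by the set $I\subseteq C$ of atoms assigned true) such that $\Pi$ has no answer set $J$ with $J\cap C=I$; it is minimal if for no $C'\subset C$ the restriction $I\cap C'$ (as an assignment over $C'$) is a u-core. -}

module Defs where

open import Data.Nat using (ℕ; zero; suc)
open import Data.Fin using (Fin)
open import Data.Bool using (Bool; true; false; not; _∧_; _∨_; if_then_else_)
open import Data.List using (List; []; _∷_; [_]; map; filter; _++_; concat)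
open import Data.Bool.ListAction using (any)
open import Data.List.Relation.Unary.All using (All)
open import Data.List.Membership.Propositional using (_∈_)
open import Data.Sum using (_⊎_; inj₁; inj₂)
open import Data.Product using (Σ; ∃; _×_; _,_)
open import Data.Empty using (⊥)
open import Relation.Nullary using (¬_)
open import Relation.Binary.PropositionalEquality using (_≡_)
open import Relation.Nullary.Decidable using (Dec; yes; no)
open import Data.Bool.Properties using () renaming (_≟_ to _≟B_)

data Head (X : Set) : Set where
  atom : X → Head X
  ⊥h   : Head X

record BasicRule (X : Set) : Set where
  constructor _←_,not_
  field
    head : Head X
    pos  : List X
    neg  : List X
open BasicRule public

data Rule (X : Set) : Set where
  rule   : Head X → List X → List X → Rule X
  choice : X → List X → List X → Rule X

Program : Set → Set
Program X = List (Rule X)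

Interp : Set → Set
Interp X = X → Bool

_⊆_ : {X : Set} → Interp X → Interp X → Set
I ⊆ J = ∀ a → I a ≡ true → J a ≡ true

_⊂_ : {X : Set} → Interp X → Interp X → Set
I ⊂ J = I ⊆ J × ∃ λ a → J a ≡ true × I a ≡ false

_∩_ : {X : Set} → Interp X → Interp X → Interp X
(I ∩ J) a = I a ∧ J a

∁ : {X : Set} → Interp X → Interp X
∁ I a = not (I a)

_≐_ : {X : Set} → Interp X → Interp X → Set
I ≐ J = ∀ a → I a ≡ J a

BodySat : {X : Set} → Interp X → BasicRule X → Set
BodySat I r = All (λ a → I a ≡ true) (pos r) × All (λ a → I a ≡ false) (neg r)

HeadSat : {X : Set} → Interp X → Head X → Set
HeadSat I (atom a) = I a ≡ true
HeadSat I ⊥h       = ⊥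

RuleSat : {X : Set} → Interp X → BasicRule X → Set
RuleSat I r = BodySat I r → HeadSat I (head r)

ReductModel : {X : Set} → List (BasicRule X) → Interp X → Interp X → Set
ReductModel Π I J = ∀ r → r ∈ Π → BodySat I r → RuleSat J r

IsAnswerSetB : {X : Set} → List (BasicRule X) → Interp X → Set
IsAnswerSetB Π I = ReductModel Π I I × (∀ J → J ⊆ I → ReductModel Π I J → I ⊆ J)

-- Choice rules as abbreviations: {α} ← B  becomes
--   α ← B, not ᾱ   and   ᾱ ← B, not α
-- with a fresh atom ᾱ per choice rule (fresh atoms: inj₂ k, k = rule position).

mapHead : {X Y : Set} → (X → Y) → Head X → Head Y
mapHead f (atom a) = atom (f a)
mapHead f ⊥h       = ⊥h

expandFrom : {X : Set} → ℕ → Program X → List (BasicRule (X ⊎ ℕ))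
expandFrom k [] = []
expandFrom k (rule h p n ∷ Π) =
  (mapHead inj₁ h ← map inj₁ p ,not map inj₁ n) ∷ expandFrom (suc k) Π
expandFrom k (choice a p n ∷ Π) =
  (atom (inj₁ a) ← map inj₁ p ,not (inj₂ k ∷ map inj₁ n)) ∷
  (atom (inj₂ k) ← map inj₁ p ,not (inj₁ a ∷ map inj₁ n)) ∷ expandFrom (suc k) Π

expand : {X : Set} → Program X → List (BasicRule (X ⊎ ℕ))
expand = expandFrom 0

-- I ∈ AS(Π): projection (onto the original atoms) of an answer set of the expansion
IsAnswerSet : {X : Set} → Program X → Interp X → Set
IsAnswerSet Π I = Σ (Interp (_ ⊎ ℕ)) λ J → IsAnswerSetB (expand Π) J × (∀ a → J (inj₁ a) ≡ I a)

meets : {n : ℕ} → Interp (Fin n) → List (Fin n) → Bool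
meets A l = any A l

drop : {n : ℕ} → Interp (Fin n) → List (Fin n) → List (Fin n)
drop A l = filter (λ a → not (A a) ≟B true) l

omitRule : {n : ℕ} → Rule (Fin n) → Interp (Fin n) → Program (Fin n)
omitRule (rule ⊥h p m) A = if meets A (p ++ m) then [] else rule ⊥h p m ∷ []
omitRule (rule (atom h) p m) A =
  if A h then []
  else (if meets A (p ++ m) then choice h (drop A p) (drop A m) ∷ []
        else rule (atom h) p m ∷ [])
omitRule (choice h p m) A =
  if A h then []
  else (if meets A (p ++ m) then choice h (drop A p) (drop A m) ∷ []
        else choice h p m ∷ [])

omit : {n : ℕ} → Program (Fin n) → Interp (Fin n) → Program (Fin n)
omit Π A = concat (map (λ r → omitRule r A) Π)

Spurious : {n : ℕ} → Program (Fin n) → Interp (Fin n) → Interp (Fin n) → Set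
Spurious Π A Î = ¬ (Σ (Interp (Fin _)) λ J → IsAnswerSet Π J × ((J ∩ ∁ A) ≐ Î))

IsUCore : {n : ℕ} → Program (Fin n) → Interp (Fin n) → Interp (Fin n) → Set
IsUCore Π C I = I ⊆ C × ¬ (Σ (Interp (Fin _)) λ J → IsAnswerSet Π J × ((J ∩ C) ≐ I))

IsMinimalUCore : {n : ℕ} → Program (Fin n) → Interp (Fin n) → Interp (Fin n) → Set
IsMinimalUCore Π C I = IsUCore Π C I × (∀ C' → C' ⊂ C → ¬ IsUCore Π C' (I ∩ C'))

MaximalFor : {n : ℕ} → Program (Fin n) → Interp (Fin n) → Interp (Fin n) → Set
MaximalFor Π A Î = ¬ (Σ (Interp (Fin _)) λ A' → A ⊂ A' × Σ (Interp (Fin _)) λ Î' →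
                     IsAnswerSet (omit Π A') Î' × Spurious Π A' Î' × ((Î ∩ ∁ A') ≐ Î'))

module Submission where

-- The u-core part is almost definitional: spuriousness says that no answer set
-- of Π agrees with Î on 𝒜 ∖ A, and Î ⊆ 𝒜 ∖ A holds because no rule of
-- omit(Π,A) has its head in A, so minimality forces every answer set of
-- omit(Π,A) to avoid A.
--
-- Minimality rests on a restriction lemma: if A ⊆ A' and Î ∈ AS(omit(Π,A)),
-- then Î ∩ (𝒜 ∖ A') ∈ AS(omit(Π,A')).  A smaller u-core Î ∩ C' with
-- C' ⊂ 𝒜 ∖ A then yields, for A' = 𝒜 ∖ C' ⊃ A, a spurious answer set of
-- omit(Π,A'), contradicting maximality.

open import Defs
open import Data.Nat using (ℕ; zero; suc; _+_)
open import Data.Nat.Properties using (+-identityʳ; +-suc)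
open import Data.Fin using (Fin)
open import Data.Product using (_×_; Σ; _,_; proj₁; proj₂)
open import Data.Sum using (_⊎_; inj₁; inj₂)
open import Data.Bool using (Bool; true; false; not; _∧_; if_then_else_)
open import Data.Bool.Properties
  using (not-involutive; not-injective; ¬-not; ∧-conicalˡ; ∧-conicalʳ) renaming (_≟_ to _≟B_)
open import Data.List using (List; []; _∷_; map; _++_)
open import Data.List.Membership.Propositional using (_∈_)
open import Data.List.Membership.Propositional.Properties
  using (∈-++⁺ˡ; ∈-++⁺ʳ; ∈-++⁻; ∈-filter⁺; ∈-filter⁻)
open import Data.List.Relation.Unary.Any using (here; there)
open import Data.List.Relation.Unary.All as All using (All; []; _∷_)
open import Data.List.Relation.Unary.All.Properties using (map⁺; map⁻)
open import Data.Unit using (⊤; tt)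
open import Relation.Binary.PropositionalEquality
  using (_≡_; refl; sym; trans; cong; subst)

false≢true : false ≡ true → ∀ {P : Set} → P
false≢true ()

not-true : ∀ {b} → not b ≡ true → b ≡ false
not-true = not-injective

⊆-false : ∀ {X : Set} {I J : Interp X} → I ⊆ J → ∀ a → J a ≡ false → I a ≡ false
⊆-false {I = I} I⊆J a Ja≡false with I a in Ia
... | false = refl
... | true  = false≢true (trans (sym Ja≡false) (I⊆J a Ia))

allTrue allFalse : {X : Set} → (X → Bool) → List X → Bool
allTrue  K []      = true
allTrue  K (a ∷ l) = K a ∧ allTrue K l
allFalse K []      = true
allFalse K (a ∷ l) = not (K a) ∧ allFalse K l

allTrue-intro : ∀ {X : Set} {K : X → Bool} {l} → All (λ a → K a ≡ true) l → allTrue K l ≡ true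
allTrue-intro []         = refl
allTrue-intro (Ka ∷ Kl) rewrite Ka = allTrue-intro Kl

allFalse-intro : ∀ {X : Set} {K : X → Bool} {l} → All (λ a → K a ≡ false) l → allFalse K l ≡ true
allFalse-intro []         = refl
allFalse-intro (Ka ∷ Kl) rewrite Ka = allFalse-intro Kl

allTrue-elim : ∀ {X : Set} {K : X → Bool} l → allTrue K l ≡ true → All (λ a → K a ≡ true) l
allTrue-elim []      _ = []
allTrue-elim (a ∷ l) e = ∧-conicalˡ _ _ e ∷ allTrue-elim l (∧-conicalʳ _ _ e)

allFalse-elim : ∀ {X : Set} {K : X → Bool} l → allFalse K l ≡ true → All (λ a → K a ≡ false) l
allFalse-elim []      _ = []
allFalse-elim (a ∷ l) e = not-true (∧-conicalˡ _ _ e) ∷ allFalse-elim l (∧-conicalʳ _ _ e)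

-- expandFrom j Π expands the rules of Π one at a time, the k-th one with fresh
-- atom index j + k; the following lemmas describe the expansion of one rule.

ruleHead : {X : Set} → Rule X → Head X
ruleHead (rule h _ _)   = h
ruleHead (choice a _ _) = atom a

rulePos ruleNeg : {X : Set} → Rule X → List X
rulePos (rule _ p _)   = p
rulePos (choice _ p _) = p
ruleNeg (rule _ _ m)   = m
ruleNeg (choice _ _ m) = m

mainRule : {X : Set} → ℕ → Rule X → BasicRule (X ⊎ ℕ)
mainRule i (rule h p m)   = mapHead inj₁ h ← map inj₁ p ,not map inj₁ m
mainRule i (choice a p m) = atom (inj₁ a) ← map inj₁ p ,not (inj₂ i ∷ map inj₁ m)

freshRule : {X : Set} → ℕ → X → List X → List X → BasicRule (X ⊎ ℕ)
freshRule i a p m = atom (inj₂ i) ← map inj₁ p ,not (inj₁ a ∷ map inj₁ m)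

expandRule : {X : Set} → ℕ → Rule X → List (BasicRule (X ⊎ ℕ))
expandRule i (rule h p m)   = mainRule i (rule h p m) ∷ []
expandRule i (choice a p m) = mainRule i (choice a p m) ∷ freshRule i a p m ∷ []

expandFrom-∷ : ∀ {X : Set} j (ρ : Rule X) Π → expandFrom j (ρ ∷ Π) ≡ expandRule j ρ ++ expandFrom (suc j) Π
expandFrom-∷ j (rule h p m)   Π = refl
expandFrom-∷ j (choice a p m) Π = refl

expandRule-cases : ∀ {X : Set} {i} {ρ : Rule X} {r} → r ∈ expandRule i ρ →
  (r ≡ mainRule i ρ) ⊎
  (Σ X λ a → Σ (List X) λ p → Σ (List X) λ m → (ρ ≡ choice a p m) × (r ≡ freshRule i a p m))
expandRule-cases {ρ = rule h p m}   (here eq)         = inj₁ eq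
expandRule-cases {ρ = choice a p m} (here eq)         = inj₁ eq
expandRule-cases {ρ = choice a p m} (there (here eq)) = inj₂ (a , p , m , refl , eq)

mainRule-∈ : ∀ {X : Set} i (ρ : Rule X) → mainRule i ρ ∈ expandRule i ρ
mainRule-∈ i (rule h p m)   = here refl
mainRule-∈ i (choice a p m) = here refl

mainRule-head : ∀ {X : Set} i (ρ : Rule X) → head (mainRule i ρ) ≡ mapHead inj₁ (ruleHead ρ)
mainRule-head i (rule h p m)   = refl
mainRule-head i (choice a p m) = refl

originalHead⇒mainRule : ∀ {X : Set} {i} {ρ : Rule X} {r} {h : X} → r ∈ expandRule i ρ →
  head r ≡ atom (inj₁ h) → (r ≡ mainRule i ρ) × (ruleHead ρ ≡ atom h)
originalHead⇒mainRule {ρ = rule (atom x) p m} (here refl) refl = refl , refl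
originalHead⇒mainRule {ρ = rule ⊥h p m}       (here refl) ()
originalHead⇒mainRule {ρ = choice a p m}      (here refl) refl = refl , refl
originalHead⇒mainRule {ρ = choice a p m}      (there (here refl)) ()

mainBody⁻ : ∀ {X : Set} {K : Interp (X ⊎ ℕ)} i (ρ : Rule X) → BodySat K (mainRule i ρ) →
  All (λ a → K (inj₁ a) ≡ true) (rulePos ρ) × All (λ a → K (inj₁ a) ≡ false) (ruleNeg ρ)
mainBody⁻ i (rule h p m)   (ps , ns)     = map⁻ ps , map⁻ ns
mainBody⁻ i (choice a p m) (ps , _ ∷ ns) = map⁻ ps , map⁻ ns

mainBody⁺ : ∀ {X : Set} {K : Interp (X ⊎ ℕ)} i (ρ : Rule X) →
  All (λ a → K (inj₁ a) ≡ true) (rulePos ρ) → All (λ a → K (inj₁ a) ≡ false) (ruleNeg ρ) →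
  K (inj₂ i) ≡ false → BodySat K (mainRule i ρ)
mainBody⁺ i (rule h p m)   ps ns _     = map⁺ ps , map⁺ ns
mainBody⁺ i (choice a p m) ps ns ᾱfalse = map⁺ ps , (ᾱfalse ∷ map⁺ ns)

data RuleAt {X : Set} : Program X → ℕ → Rule X → Set where
  atHead : ∀ {ρ Π} → RuleAt (ρ ∷ Π) 0 ρ
  atTail : ∀ {σ Π i ρ} → RuleAt Π i ρ → RuleAt (σ ∷ Π) (suc i) ρ

RuleAt⇒∈ : ∀ {X : Set} {Π : Program X} {i ρ} → RuleAt Π i ρ → ρ ∈ Π
RuleAt⇒∈ atHead      = here refl
RuleAt⇒∈ (atTail at) = there (RuleAt⇒∈ at)

∈⇒RuleAt : ∀ {X : Set} {Π : Program X} {ρ} → ρ ∈ Π → Σ ℕ λ i → RuleAt Π i ρ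
∈⇒RuleAt (here refl) = 0 , atHead
∈⇒RuleAt (there ρ∈Π) with ∈⇒RuleAt ρ∈Π
... | i , at = suc i , atTail at

expand⁺ : ∀ {X : Set} j {Π : Program X} {i ρ r} → RuleAt Π i ρ →
  r ∈ expandRule (j + i) ρ → r ∈ expandFrom j Π
expand⁺ j {ρ ∷ Π} {r = r} atHead r∈ =
  subst (r ∈_) (sym (expandFrom-∷ j ρ Π))
    (∈-++⁺ˡ (subst (λ k → r ∈ expandRule k ρ) (+-identityʳ j) r∈))
expand⁺ j {σ ∷ Π} {suc i} {ρ} {r} (atTail at) r∈ =
  subst (r ∈_) (sym (expandFrom-∷ j σ Π))
    (∈-++⁺ʳ (expandRule j σ) (expand⁺ (suc j) at (subst (λ k → r ∈ expandRule k ρ) (+-suc j i) r∈)))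

expand⁻ : ∀ {X : Set} j (Π : Program X) {r} → r ∈ expandFrom j Π →
  Σ (Rule X) λ ρ → Σ ℕ λ i → RuleAt Π i ρ × r ∈ expandRule (j + i) ρ
expand⁻ j (σ ∷ Π) {r} r∈ with ∈-++⁻ (expandRule j σ) (subst (r ∈_) (expandFrom-∷ j σ Π) r∈)
... | inj₁ r∈σ = σ , 0 , atHead , subst (λ k → r ∈ expandRule k σ) (sym (+-identityʳ j)) r∈σ
... | inj₂ r∈Π with expand⁻ (suc j) Π r∈Π
...   | ρ , i , at , r∈ρ = ρ , suc i , atTail at , subst (λ k → r ∈ expandRule k ρ) (sym (+-suc j i)) r∈ρ

-- The value the fresh atom of ρ must take under K: ρ is a choice rule whose
-- body holds and whose head is false.
choiceFires : {X : Set} → (X → Bool) → Rule X → Bool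
choiceFires K (rule _ _ _)   = false
choiceFires K (choice a p m) = not (K a) ∧ allTrue K p ∧ allFalse K m

choiceFires-false : ∀ {X : Set} (K : X → Bool) (ρ : Rule X) {h} → ruleHead ρ ≡ atom h →
  K h ≡ true → choiceFires K ρ ≡ false
choiceFires-false K (rule _ _ _)   _    _  = refl
choiceFires-false K (choice a p m) refl Ka rewrite Ka = refl

freshValues : {X : Set} → Program X → (X → Bool) → ℕ → Bool
freshValues []      K i       = false
freshValues (ρ ∷ Π) K zero    = choiceFires K ρ
freshValues (ρ ∷ Π) K (suc i) = freshValues Π K i

freshValues-at : ∀ {X : Set} {Π : Program X} {i ρ} (K : X → Bool) → RuleAt Π i ρ →
  freshValues Π K i ≡ choiceFires K ρ
freshValues-at K atHead      = refl
freshValues-at K (atTail at) = freshValues-at K at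

freshValues-true : ∀ {X : Set} (Π : Program X) (K : X → Bool) i → freshValues Π K i ≡ true →
  Σ (Rule X) λ ρ → RuleAt Π i ρ × choiceFires K ρ ≡ true
freshValues-true (ρ ∷ Π) K zero    fires = ρ , atHead , fires
freshValues-true (ρ ∷ Π) K (suc i) fires with freshValues-true Π K i fires
... | σ , at , σfires = σ , atTail at , σfires

omit⁻ : ∀ {n} {Π : Program (Fin n)} {B ρ'} → ρ' ∈ omit Π B →
  Σ (Rule (Fin n)) λ ρ → (ρ ∈ Π) × (ρ' ∈ omitRule ρ B)
omit⁻ {Π = σ ∷ Π} {B} ρ'∈ with ∈-++⁻ (omitRule σ B) ρ'∈
... | inj₁ ρ'∈σ = σ , here refl , ρ'∈σ
... | inj₂ ρ'∈Π with omit⁻ {Π = Π} ρ'∈Π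
...   | ρ , ρ∈Π , ρ'∈ρ = ρ , there ρ∈Π , ρ'∈ρ

omit⁺ : ∀ {n} {Π : Program (Fin n)} {B ρ ρ'} → ρ ∈ Π → ρ' ∈ omitRule ρ B → ρ' ∈ omit Π B
omit⁺ {Π = σ ∷ Π}     (here refl) ρ'∈ = ∈-++⁺ˡ ρ'∈
omit⁺ {Π = σ ∷ Π} {B} (there ρ∈Π) ρ'∈ = ∈-++⁺ʳ (omitRule σ B) (omit⁺ ρ∈Π ρ'∈)

meets-false : ∀ {n} (B : Interp (Fin n)) (l : List (Fin n)) {a} → meets B l ≡ false → a ∈ l → B a ≡ false
meets-false B (x ∷ l) e (here refl) with B x
... | false = refl
meets-false B (x ∷ l) () (here refl) | true
meets-false B (x ∷ l) e (there a∈) with B x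
... | false = meets-false B l e a∈
meets-false B (x ∷ l) () (there a∈) | true

meets-antitone : ∀ {n} {B B' : Interp (Fin n)} → B ⊆ B' → (l : List (Fin n)) →
  meets B' l ≡ false → meets B l ≡ false
meets-antitone B⊆B' []      e = refl
meets-antitone {B' = B'} B⊆B' (x ∷ l) e with B' x in B'x
meets-antitone B⊆B' (x ∷ l) () | true
... | false rewrite ⊆-false B⊆B' x B'x = meets-antitone B⊆B' l e

drop⁻ : ∀ {n} (B : Interp (Fin n)) l {a} → a ∈ drop B l → a ∈ l × B a ≡ false
drop⁻ B l a∈ with ∈-filter⁻ (λ a → not (B a) ≟B true) {xs = l} a∈
... | a∈l , notBa = a∈l , not-true notBa

drop⁺ : ∀ {n} (B : Interp (Fin n)) l {a} → a ∈ l → B a ≡ false → a ∈ drop B l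
drop⁺ B l a∈ Ba = ∈-filter⁺ (λ a → not (B a) ≟B true) a∈ (cong not Ba)

HeadAvoids : ∀ {n} → Interp (Fin n) → Head (Fin n) → Set
HeadAvoids B ⊥h       = ⊤
HeadAvoids B (atom h) = B h ≡ false

data Omits {n} (B : Interp (Fin n)) : Rule (Fin n) → Rule (Fin n) → Set where
  keepRule   : ∀ {h p m} → meets B (p ++ m) ≡ false → HeadAvoids B h →
               Omits B (rule h p m) (rule h p m)
  keepChoice : ∀ {h p m} → meets B (p ++ m) ≡ false → B h ≡ false →
               Omits B (choice h p m) (choice h p m)
  relaxRule   : ∀ {h p m} → meets B (p ++ m) ≡ true → B h ≡ false →
               Omits B (rule (atom h) p m) (choice h (drop B p) (drop B m))
  relaxChoice : ∀ {h p m} → meets B (p ++ m) ≡ true → B h ≡ false →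
               Omits B (choice h p m) (choice h (drop B p) (drop B m))

omitRule⇒Omits : ∀ {n} {B : Interp (Fin n)} (ρ : Rule (Fin n)) {ρ'} → ρ' ∈ omitRule ρ B → Omits B ρ ρ'
omitRule⇒Omits {B = B} (rule ⊥h p m) ρ'∈ with meets B (p ++ m) in Bm
omitRule⇒Omits (rule ⊥h p m) ()          | true
omitRule⇒Omits (rule ⊥h p m) (here refl) | false = keepRule Bm tt
omitRule⇒Omits {B = B} (rule (atom h) p m) ρ'∈ with B h in Bh
omitRule⇒Omits (rule (atom h) p m) () | true
... | false with meets B (p ++ m) in Bm
omitRule⇒Omits (rule (atom h) p m) (here refl) | false | true  = relaxRule Bm Bh
omitRule⇒Omits (rule (atom h) p m) (here refl) | false | false = keepRule Bm Bh
omitRule⇒Omits {B = B} (choice h p m) ρ'∈ with B h in Bh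
omitRule⇒Omits (choice h p m) () | true
... | false with meets B (p ++ m) in Bm
omitRule⇒Omits (choice h p m) (here refl) | false | true  = relaxChoice Bm Bh
omitRule⇒Omits (choice h p m) (here refl) | false | false = keepChoice Bm Bh

Omits⇒omitRule : ∀ {n} {B : Interp (Fin n)} {ρ ρ'} → Omits B ρ ρ' → ρ' ∈ omitRule ρ B
Omits⇒omitRule (keepRule {h = ⊥h} Bm _)     rewrite Bm = here refl
Omits⇒omitRule (keepRule {h = atom h} Bm Bh) rewrite Bh | Bm = here refl
Omits⇒omitRule (keepChoice Bm Bh)  rewrite Bh | Bm = here refl
Omits⇒omitRule (relaxRule Bm Bh)   rewrite Bh | Bm = here refl
Omits⇒omitRule (relaxChoice Bm Bh) rewrite Bh | Bm = here refl

Omits-exists : ∀ {n} (B : Interp (Fin n)) (ρ : Rule (Fin n)) {h} → ruleHead ρ ≡ atom h → B h ≡ false →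
  Σ (Rule (Fin n)) λ ρ' → Omits B ρ ρ'
Omits-exists B (rule (atom h) p m) refl Bh with meets B (p ++ m) in Bm
... | true  = _ , relaxRule Bm Bh
... | false = _ , keepRule Bm Bh
Omits-exists B (choice h p m) refl Bh with meets B (p ++ m) in Bm
... | true  = _ , relaxChoice Bm Bh
... | false = _ , keepChoice Bm Bh

Omits-head : ∀ {n} {B : Interp (Fin n)} {ρ ρ'} → Omits B ρ ρ' → ruleHead ρ' ≡ ruleHead ρ
Omits-head (keepRule _ _)    = refl
Omits-head (keepChoice _ _)  = refl
Omits-head (relaxRule _ _)   = refl
Omits-head (relaxChoice _ _) = refl

Omits-headAvoids : ∀ {n} {B : Interp (Fin n)} {ρ ρ'} → Omits B ρ ρ' → HeadAvoids B (ruleHead ρ')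
Omits-headAvoids (keepRule _ ok)    = ok
Omits-headAvoids (keepChoice _ Bh)  = Bh
Omits-headAvoids (relaxRule _ Bh)   = Bh
Omits-headAvoids (relaxChoice _ Bh) = Bh

Omits-pos⁻ : ∀ {n} {B : Interp (Fin n)} {ρ ρ'} → Omits B ρ ρ' →
  ∀ {a} → a ∈ rulePos ρ' → a ∈ rulePos ρ × B a ≡ false
Omits-pos⁻ {B = B} (keepRule {p = p} {m} Bm _)   a∈ = a∈ , meets-false B (p ++ m) Bm (∈-++⁺ˡ a∈)
Omits-pos⁻ {B = B} (keepChoice {p = p} {m} Bm _) a∈ = a∈ , meets-false B (p ++ m) Bm (∈-++⁺ˡ a∈)
Omits-pos⁻ {B = B} (relaxRule {p = p} _ _)       a∈ = drop⁻ B p a∈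
Omits-pos⁻ {B = B} (relaxChoice {p = p} _ _)     a∈ = drop⁻ B p a∈

Omits-neg⁻ : ∀ {n} {B : Interp (Fin n)} {ρ ρ'} → Omits B ρ ρ' →
  ∀ {a} → a ∈ ruleNeg ρ' → a ∈ ruleNeg ρ × B a ≡ false
Omits-neg⁻ {B = B} (keepRule {p = p} {m} Bm _)   a∈ = a∈ , meets-false B (p ++ m) Bm (∈-++⁺ʳ p a∈)
Omits-neg⁻ {B = B} (keepChoice {p = p} {m} Bm _) a∈ = a∈ , meets-false B (p ++ m) Bm (∈-++⁺ʳ p a∈)
Omits-neg⁻ {B = B} (relaxRule {m = m} _ _)       a∈ = drop⁻ B m a∈
Omits-neg⁻ {B = B} (relaxChoice {m = m} _ _)     a∈ = drop⁻ B m a∈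

Omits-pos⁺ : ∀ {n} {B : Interp (Fin n)} {ρ ρ'} → Omits B ρ ρ' →
  ∀ {a} → a ∈ rulePos ρ → B a ≡ false → a ∈ rulePos ρ'
Omits-pos⁺ (keepRule _ _)                a∈ _  = a∈
Omits-pos⁺ (keepChoice _ _)              a∈ _  = a∈
Omits-pos⁺ {B = B} (relaxRule {p = p} _ _)   a∈ Ba = drop⁺ B p a∈ Ba
Omits-pos⁺ {B = B} (relaxChoice {p = p} _ _) a∈ Ba = drop⁺ B p a∈ Ba

Omits-neg⁺ : ∀ {n} {B : Interp (Fin n)} {ρ ρ'} → Omits B ρ ρ' →
  ∀ {a} → a ∈ ruleNeg ρ → B a ≡ false → a ∈ ruleNeg ρ'
Omits-neg⁺ (keepRule _ _)                a∈ _  = a∈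
Omits-neg⁺ (keepChoice _ _)              a∈ _  = a∈
Omits-neg⁺ {B = B} (relaxRule {m = m} _ _)   a∈ Ba = drop⁺ B m a∈ Ba
Omits-neg⁺ {B = B} (relaxChoice {m = m} _ _) a∈ Ba = drop⁺ B m a∈ Ba

omittedMainRule : ∀ {n} (Π : Program (Fin n)) (B : Interp (Fin n)) {r h} →
  r ∈ expand (omit Π B) → head r ≡ atom (inj₁ h) →
  Σ (Rule (Fin n)) λ ρ → Σ (Rule (Fin n)) λ ρ' → Σ ℕ λ i →
    (ρ ∈ Π) × Omits B ρ ρ' × (r ≡ mainRule i ρ') × (ruleHead ρ' ≡ atom h)
omittedMainRule Π B r∈ hr with expand⁻ 0 (omit Π B) r∈
... | ρ' , i , at , r∈ρ' with omit⁻ {Π = Π} (RuleAt⇒∈ at)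
...   | ρ , ρ∈Π , ρ'∈ with originalHead⇒mainRule {ρ = ρ'} r∈ρ' hr
...     | r≡main , hd = ρ , ρ' , i , ρ∈Π , omitRule⇒Omits ρ ρ'∈ , r≡main , hd

omit-headAvoids : ∀ {n} (Π : Program (Fin n)) (B : Interp (Fin n)) {r h} →
  r ∈ expand (omit Π B) → head r ≡ atom (inj₁ h) → B h ≡ false
omit-headAvoids Π B r∈ hr with omittedMainRule Π B r∈ hr
... | _ , _ , _ , _ , om , _ , hd = subst (HeadAvoids B) hd (Omits-headAvoids om)

choiceFires-true : ∀ {X : Set} (K : X → Bool) a p m → K a ≡ false →
  All (λ x → K x ≡ true) p → All (λ x → K x ≡ false) m → choiceFires K (choice a p m) ≡ true
choiceFires-true K a p m Ka ps ns rewrite Ka | allTrue-intro ps | allFalse-intro ns = refl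

choice-satisfied : ∀ {X : Set} (L : Interp (X ⊎ ℕ)) i a p m →
  L (inj₂ i) ≡ choiceFires (λ x → L (inj₁ x)) (choice a p m) →
  ∀ r → r ∈ expandRule i (choice a p m) → RuleSat L r
choice-satisfied L i a p m ᾱ≡ r r∈ bs with expandRule-cases {ρ = choice a p m} r∈
choice-satisfied L i a p m ᾱ≡ r r∈ (ps , ᾱfalse ∷ ns) | inj₁ refl =
  ¬-not λ La → false≢true (trans (sym ᾱfalse)
    (trans ᾱ≡ (choiceFires-true _ a p m La (map⁻ ps) (map⁻ ns))))
choice-satisfied L i a p m ᾱ≡ r r∈ (ps , afalse ∷ ns) | inj₂ (_ , _ , _ , refl , refl) =
  trans ᾱ≡ (choiceFires-true _ a p m afalse (map⁻ ps) (map⁻ ns))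

-- Removing the atoms of B from an answer set K still models the reduct, since
-- no rule derives an atom of B; by minimality K contains no atom of B.
expandedAnswerSet-avoids : ∀ {n} (Π : Program (Fin n)) (B : Interp (Fin n)) (K : Interp (Fin n ⊎ ℕ)) →
  IsAnswerSetB (expand (omit Π B)) K → ∀ a → K (inj₁ a) ≡ true → B a ≡ false
expandedAnswerSet-avoids {n} Π B K (K-model , K-minimal) a Ka =
  not-true (∧-conicalʳ _ _ (K-minimal K∖B K∖B⊆K K∖B-model (inj₁ a) Ka))
  where
  K∖B : Interp (Fin n ⊎ ℕ)
  K∖B (inj₁ x) = K (inj₁ x) ∧ not (B x)
  K∖B (inj₂ k) = K (inj₂ k)

  K∖B⊆K : K∖B ⊆ K
  K∖B⊆K (inj₁ x) e = ∧-conicalˡ _ _ e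
  K∖B⊆K (inj₂ k) e = e

  K∖B-model : ReductModel (expand (omit Π B)) K K∖B
  K∖B-model (⊥h ← p ,not m)            r∈ bs _ = K-model _ r∈ bs bs
  K∖B-model (atom (inj₂ k) ← p ,not m) r∈ bs _ = K-model _ r∈ bs bs
  K∖B-model (atom (inj₁ h) ← p ,not m) r∈ bs _
    rewrite K-model _ r∈ bs bs | omit-headAvoids Π B r∈ refl = refl

answerSet-avoids : ∀ {n} (Π : Program (Fin n)) {B Î : Interp (Fin n)} →
  IsAnswerSet (omit Π B) Î → Î ⊆ ∁ B
answerSet-avoids Π {B} (K , K-answerSet , K≡Î) a Îa =
  cong not (expandedAnswerSet-avoids Π B K K-answerSet a (trans (K≡Î a) Îa))

-- Restriction: for A ⊆ A', an answer set K of omit(Π,A) restricts to the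
-- answer set K' of omit(Π,A') that keeps the original atoms of K outside A'
-- and gives every fresh atom of omit(Π,A') its canonical value.
module Restriction {n : ℕ} (Π : Program (Fin n)) (A A' : Interp (Fin n)) (A⊆A' : A ⊆ A')
  (K : Interp (Fin n ⊎ ℕ)) (K-answerSet : IsAnswerSetB (expand (omit Π A)) K) where

  K-model : ReductModel (expand (omit Π A)) K K
  K-model = proj₁ K-answerSet

  K₀ : Interp (Fin n)
  K₀ = (λ a → K (inj₁ a)) ∩ ∁ A'

  K' : Interp (Fin n ⊎ ℕ)
  K' (inj₁ a) = K₀ a
  K' (inj₂ k) = freshValues (omit Π A') K₀ k

  K₀-intro : ∀ {a} → K (inj₁ a) ≡ true → A' a ≡ false → K₀ a ≡ true
  K₀-intro Ka A'a rewrite Ka | A'a = refl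

  K₀-elim : ∀ {a} → K₀ a ≡ true → K (inj₁ a) ≡ true × A' a ≡ false
  K₀-elim e = ∧-conicalˡ _ _ e , not-true (∧-conicalʳ _ _ e)

  K₀-false : ∀ {a} → K (inj₁ a) ≡ false → K₀ a ≡ false
  K₀-false Ka rewrite Ka = refl

  K₀-false⁻ : ∀ {a} → K₀ a ≡ false → A' a ≡ false → K (inj₁ a) ≡ false
  K₀-false⁻ {a} K₀a A'a = ⊆-false (λ _ Ka → K₀-intro Ka A'a) a K₀a

  -- A rule whose body avoids A' is kept by both omissions, so K' inherits its
  -- satisfaction from K.
  keptRule-satisfied : ∀ {hd p m} → rule hd p m ∈ Π → meets A' (p ++ m) ≡ false → HeadAvoids A' hd →
    RuleSat K' (mainRule 0 (rule hd p m))
  keptRule-satisfied {hd} {p} {m} ρ∈Π A'm ok (ps , ns) = inherit hd ok (K-model _ inExpandP bodyK bodyK)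
    where
    headAvoids-antitone : ∀ hd → HeadAvoids A' hd → HeadAvoids A hd
    headAvoids-antitone ⊥h       _   = tt
    headAvoids-antitone (atom h) A'h = ⊆-false A⊆A' h A'h

    keptByA : Omits A (rule hd p m) (rule hd p m)
    keptByA = keepRule (meets-antitone A⊆A' (p ++ m) A'm) (headAvoids-antitone hd ok)

    inExpandP : mainRule 0 (rule hd p m) ∈ expand (omit Π A)
    inExpandP with ∈⇒RuleAt (omit⁺ {Π = Π} ρ∈Π (Omits⇒omitRule keptByA))
    ... | i , at = expand⁺ 0 at (mainRule-∈ i (rule hd p m))

    bodyK : BodySat K (mainRule 0 (rule hd p m))
    bodyK = map⁺ (All.map (λ K₀a → proj₁ (K₀-elim K₀a)) (map⁻ ps)) ,
            map⁺ (All.tabulate (λ a∈ → K₀-false⁻ (All.lookup (map⁻ ns) a∈)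
                                                 (meets-false A' (p ++ m) A'm (∈-++⁺ʳ p a∈))))

    inherit : ∀ hd → HeadAvoids A' hd → HeadSat K (mapHead inj₁ hd) → HeadSat K' (mapHead inj₁ hd)
    inherit (atom h) A'h Kh = K₀-intro Kh A'h

  -- Rules of omit(Π,A') are kept rules or choice rules, so K' models the reduct.
  K'-model : ReductModel (expand (omit Π A')) K' K'
  K'-model r r∈ bs with expand⁻ 0 (omit Π A') r∈
  ... | ρ' , i , at , r∈ρ' with omit⁻ {Π = Π} (RuleAt⇒∈ at)
  ...   | ρ , ρ∈Π , ρ'∈ with omitRule⇒Omits ρ ρ'∈
  ...     | keepChoice _ _  = choice-satisfied K' i _ _ _ (freshValues-at K₀ at) r r∈ρ'
  ...     | relaxRule _ _   = choice-satisfied K' i _ _ _ (freshValues-at K₀ at) r r∈ρ'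
  ...     | relaxChoice _ _ = choice-satisfied K' i _ _ _ (freshValues-at K₀ at) r r∈ρ'
  ...     | keepRule {h = hd} {p} {m} A'm ok with expandRule-cases {i = i} {ρ = rule hd p m} r∈ρ'
  ...       | inj₁ refl = keptRule-satisfied ρ∈Π A'm ok
  ...       | inj₂ (_ , _ , _ , () , _)

  -- Patching L with K on A' and on the fresh atoms gives a model L̂ ⊆ K of the
  -- reduct of omit(Π,A) w.r.t. K, so K ⊆ L̂ by minimality of K.
  module Minimality (L : Interp (Fin n ⊎ ℕ)) (L⊆K' : L ⊆ K')
    (L-model : ReductModel (expand (omit Π A')) K' L) where

    L̂ : Interp (Fin n ⊎ ℕ)
    L̂ (inj₁ a) = if A' a then K (inj₁ a) else L (inj₁ a)
    L̂ (inj₂ k) = K (inj₂ k)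

    L̂-outside : ∀ {a} → A' a ≡ false → L̂ (inj₁ a) ≡ L (inj₁ a)
    L̂-outside A'a rewrite A'a = refl

    L̂⊆K : L̂ ⊆ K
    L̂⊆K (inj₁ a) e with A' a
    ... | true  = e
    ... | false = ∧-conicalˡ _ _ (L⊆K' (inj₁ a) e)
    L̂⊆K (inj₂ k) e = e

    -- A rule of omit(Π,A) deriving h ∉ A', with body true under K and L̂, has a
    -- counterpart in omit(Π,A') whose body holds under K' and L; hence h ∈ L.
    L-derives : ∀ {h} r → r ∈ expand (omit Π A) → head r ≡ atom (inj₁ h) → A' h ≡ false →
      K (inj₁ h) ≡ true → BodySat K r → BodySat L̂ r → L (inj₁ h) ≡ true
    L-derives {h} r r∈ hr A'h Kh bodyK bodyL̂ with omittedMainRule Π A r∈ hr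
    ... | ρ , ρA , j , ρ∈Π , omA , refl , headA
      with Omits-exists A' ρ (trans (sym (Omits-head omA)) headA) A'h
    ...   | ρA' , omA' with ∈⇒RuleAt (omit⁺ {Π = Π} ρ∈Π (Omits⇒omitRule omA'))
    ...     | i , at = subst (HeadSat L) headA'
                         (L-model _ (expand⁺ 0 at (mainRule-∈ i ρA')) bodyK' bodyL)
      where
      headA' : head (mainRule i ρA') ≡ atom (inj₁ h)
      headA' = trans (mainRule-head i ρA')
                     (cong (mapHead inj₁) (trans (Omits-head omA') (trans (sym (Omits-head omA)) headA)))

      posA' : ∀ {a} → a ∈ rulePos ρA' → a ∈ rulePos ρA × A' a ≡ false
      posA' a∈ with Omits-pos⁻ omA' a∈
      ... | a∈ρ , A'a = Omits-pos⁺ omA a∈ρ (⊆-false A⊆A' _ A'a) , A'a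

      negA' : ∀ {a} → a ∈ ruleNeg ρA' → a ∈ ruleNeg ρA × A' a ≡ false
      negA' a∈ with Omits-neg⁻ omA' a∈
      ... | a∈ρ , A'a = Omits-neg⁺ omA a∈ρ (⊆-false A⊆A' _ A'a) , A'a

      ᾱfalse : K' (inj₂ i) ≡ false
      ᾱfalse = trans (freshValues-at K₀ at)
                     (choiceFires-false K₀ ρA' (trans (Omits-head omA') (trans (sym (Omits-head omA)) headA))
                                        (K₀-intro Kh A'h))

      negK₀ : ∀ {a} → a ∈ ruleNeg ρA' → K₀ a ≡ false
      negK₀ a∈ = K₀-false (All.lookup (proj₂ (mainBody⁻ j ρA bodyK)) (proj₁ (negA' a∈)))

      bodyK' : BodySat K' (mainRule i ρA')
      bodyK' = mainBody⁺ i ρA'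
        (All.tabulate λ a∈ → K₀-intro (All.lookup (proj₁ (mainBody⁻ j ρA bodyK)) (proj₁ (posA' a∈)))
                                      (proj₂ (posA' a∈)))
        (All.tabulate negK₀) ᾱfalse

      bodyL : BodySat L (mainRule i ρA')
      bodyL = mainBody⁺ i ρA'
        (All.tabulate λ a∈ → trans (sym (L̂-outside (proj₂ (posA' a∈))))
                                   (All.lookup (proj₁ (mainBody⁻ j ρA bodyL̂)) (proj₁ (posA' a∈))))
        (All.tabulate λ a∈ → ⊆-false L⊆K' _ (negK₀ a∈))
        (⊆-false L⊆K' _ ᾱfalse)

    L̂-model : ReductModel (expand (omit Π A)) K L̂
    L̂-model (⊥h ← p ,not m)            r∈ bodyK _ = K-model _ r∈ bodyK bodyK
    L̂-model (atom (inj₂ k) ← p ,not m) r∈ bodyK _ = K-model _ r∈ bodyK bodyK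
    L̂-model (atom (inj₁ h) ← p ,not m) r∈ bodyK bodyL̂ with A' h in A'h
    ... | true  = K-model _ r∈ bodyK bodyK
    ... | false = L-derives _ r∈ refl A'h (K-model _ r∈ bodyK bodyK) bodyK bodyL̂

    K⊆L̂ : K ⊆ L̂
    K⊆L̂ = proj₂ K-answerSet L̂ L̂⊆K L̂-model

    K₀⊆L : ∀ a → K₀ a ≡ true → L (inj₁ a) ≡ true
    K₀⊆L a K₀a with K₀-elim K₀a
    ... | Ka , A'a = trans (sym (L̂-outside A'a)) (K⊆L̂ (inj₁ a) Ka)

    -- A true fresh atom of omit(Π,A') is derived by its fresh rule, whose body
    -- holds under K' and, by K₀ ⊆ L and L ⊆ K', under L.
    K'⊆L : K' ⊆ L
    K'⊆L (inj₁ a) K'a = K₀⊆L a K'a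
    K'⊆L (inj₂ k) K'ᾱ with freshValues-true (omit Π A') K₀ k K'ᾱ
    ... | choice h p m , at , fires =
      L-model _ (expand⁺ 0 at (there (here refl)))
        (map⁺ ps , (hfalse ∷ map⁺ ns))
        (map⁺ (All.map (K₀⊆L _) ps) , (⊆-false L⊆K' _ hfalse ∷ map⁺ (All.map (⊆-false L⊆K' _) ns)))
      where
      hfalse : K₀ h ≡ false
      hfalse = not-true (∧-conicalˡ _ _ fires)
      ps : All (λ a → K₀ a ≡ true) p
      ps = allTrue-elim p (∧-conicalˡ _ _ (∧-conicalʳ (not (K₀ h)) _ fires))
      ns : All (λ a → K₀ a ≡ false) m
      ns = allFalse-elim m (∧-conicalʳ _ _ (∧-conicalʳ (not (K₀ h)) _ fires))

  K'-answerSet : IsAnswerSetB (expand (omit Π A')) K'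
  K'-answerSet = K'-model , λ L L⊆K' L-model → Minimality.K'⊆L L L⊆K' L-model

restrict-answerSet : ∀ {n} (Π : Program (Fin n)) {A A' Î : Interp (Fin n)} → A ⊆ A' →
  IsAnswerSet (omit Π A) Î → IsAnswerSet (omit Π A') (Î ∩ ∁ A')
restrict-answerSet Π {A} {A'} A⊆A' (K , K-answerSet , K≡Î) =
  R.K' , R.K'-answerSet , λ a → cong (λ b → b ∧ not (A' a)) (K≡Î a)
  where module R = Restriction Π A A' A⊆A' K K-answerSet

spurious⇒uCore : ∀ {n} (Π : Program (Fin n)) {A Î : Interp (Fin n)} →
  IsAnswerSet (omit Π A) Î → Spurious Π A Î → IsUCore Π (∁ A) Î
spurious⇒uCore Π Î-answerSet spurious = answerSet-avoids Π Î-answerSet , spurious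

uCore⇒spurious : ∀ {n} {Π : Program (Fin n)} {C I : Interp (Fin n)} →
  IsUCore Π C (I ∩ C) → Spurious Π (∁ C) (I ∩ ∁ (∁ C))
uCore⇒spurious {C = C} {I} (_ , noAnswerSet) (J , J-answerSet , J≐) =
  noAnswerSet (J , J-answerSet ,
    λ a → subst (λ c → J a ∧ c ≡ I a ∧ c) (not-involutive (C a)) (J≐ a))

⊂-∁ : ∀ {X : Set} {A C : Interp X} → C ⊂ ∁ A → A ⊂ ∁ C
⊂-∁ {A = A} {C} (C⊆∁A , a , ∁Aa , Ca) = A⊆∁C , a , cong not Ca , not-true ∁Aa
  where
  A⊆∁C : A ⊆ ∁ C
  A⊆∁C x Ax = cong not (⊆-false C⊆∁A x (cong not Ax))

proposition26 : (n : ℕ) (Π : Program (Fin n)) (A Î : Interp (Fin n)) →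
    IsAnswerSet (omit Π A) Î → Spurious Π A Î →
    IsUCore Π (∁ A) Î × (MaximalFor Π A Î → IsMinimalUCore Π (∁ A) Î)
proposition26 n Π A Î Î-answerSet spurious = uCore , minimal
  where
  uCore : IsUCore Π (∁ A) Î
  uCore = spurious⇒uCore Π Î-answerSet spurious

  -- A smaller u-core Î ∩ C' yields, for A' = 𝒜 ∖ C' ⊃ A, the spurious answer
  -- set Î ∩ (𝒜 ∖ A') of omit(Π,A'), which maximality of A excludes.
  minimal : MaximalFor Π A Î → IsMinimalUCore Π (∁ A) Î
  minimal maximal = uCore , λ C' C'⊂∁A C'-uCore →
    maximal (∁ C' , ⊂-∁ C'⊂∁A , Î ∩ ∁ (∁ C') ,
             restrict-answerSet Π (proj₁ (⊂-∁ C'⊂∁A)) Î-answerSet ,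
             uCore⇒spurious C'-uCore , λ _ → refl)
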